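{- If a graph $G$ has minimum degree at least $2$ and girth greater than $4$, then $G$ is distance critical.
   Context: All graphs are finite, simple and undirected. The girth of a graph is the length of its shortest cycle. For vertices $x,y$ of a graph $G$, $d_G(x,y)$ is the length of a shortest path from $x$ to $y$ in $G$ ($\infty$ if none exists). A graph $G$ is distance critical if for every vertex $v \in V(G)$ there exist vertices $x,y \in V(G)\setminus\{v\}$ with $d_G(x,y) \neq d_{G-v}(x,y)$. -}

module Defs where

open import Data.Nat using (ℕ; zero; suc; _≤_; _<_)
open import Data.Fin using (Fin; zero; suc; inject₁; fromℕ)
open import Data.Maybe using (Maybe; just; nothing)
open import Data.Product using (Σ; _×_; ∃-syntax; _,_)
open import Data.Unit using (⊤)
open import Relation.Nullary using (¬_; Dec)
open import Relation.Binary.PropositionalEquality using (_≡_; _≢_)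
open import Function.Definitions using (Injective)

record Graph (n : ℕ) : Set₁ where
  field
    Adj    : Fin n → Fin n → Set
    sym    : ∀ {x y} → Adj x y → Adj y x
    irrefl : ∀ {x} → ¬ Adj x x
    dec    : ∀ x y → Dec (Adj x y)

open Graph public

module _ {n : ℕ} (G : Graph n) where

  MinDegreeAtLeast2 : Set
  MinDegreeAtLeast2 = ∀ v → ∃[ u ] ∃[ w ] (u ≢ w × Adj G v u × Adj G v w)

  -- A cycle with suc m vertices (length suc m): distinct vertices
  -- f 0, …, f m with f i ~ f (i+1) for i < m and f m ~ f 0.
  -- (Cycles have length ≥ 3, i.e. m ≥ 2; this is imposed where used.)
  CycleOn : ℕ → Set
  CycleOn m =
    Σ (Fin (suc m) → Fin n) (λ f →
      Injective _≡_ _≡_ f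
      × (∀ (i : Fin m) → Adj G (f (inject₁ i)) (f (suc i)))
      × Adj G (f (fromℕ m)) (f zero))

  GirthGreaterThan4 : Set
  GirthGreaterThan4 = ∀ m → 2 ≤ m → m ≤ 3 → ¬ CycleOn m

  -- Walks of length k from x to y all of whose vertices satisfy P
  -- (P = "≠ v" gives walks in the vertex-deleted subgraph G - v).
  data Walk (P : Fin n → Set) : Fin n → Fin n → ℕ → Set where
    [] : ∀ {x} → P x → Walk P x x zero
    _∷_ : ∀ {x y z k} → P x → Adj G x y → Walk P y z k → Walk P x z (suc k)

  -- d (restricted to walks inside P) from x to y equals d;
  -- nothing encodes distance ∞.
  IsDist : (Fin n → Set) → Fin n → Fin n → Maybe ℕ → Set
  IsDist P x y (just k) = Walk P x y k × (∀ j → j < k → ¬ Walk P x y j)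
  IsDist P x y nothing  = ∀ k → ¬ Walk P x y k

  IsDistG : Fin n → Fin n → Maybe ℕ → Set
  IsDistG = IsDist (λ _ → ⊤)

  IsDistMinus : Fin n → Fin n → Fin n → Maybe ℕ → Set
  IsDistMinus v = IsDist (λ u → u ≢ v)

  DistanceCritical : Set
  DistanceCritical =
    ∀ v → ∃[ x ] ∃[ y ] (x ≢ v × y ≢ v ×
      ∃[ d ] ∃[ d' ] (IsDistG x y d × IsDistMinus v x y d' × d ≢ d'))

{-# OPTIONS --safe #-}
module Submission where

-- Let u ≠ w be two neighbours of v. Without triangles u and w are not
-- adjacent, so d_G(u,w) = 2; without 4-cycles v is their only common
-- neighbour, so no walk of length 2 joins them in G - v. Constructively,
-- d_{G-v}(u,w) must also be exhibited: it is found by bounded search,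
-- since every walk can be shortened to one of length less than n.

open import Data.Nat using (ℕ; zero; suc; _<_; z≤n; s≤s)
open import Data.Nat.Properties using (≤-refl; n≤1+n; <-≤-trans; ≤-<-trans; m<1+n⇒m<n∨m≡n)
open import Data.Nat.Induction using (<-wellFounded)
open import Data.Fin using (zero; suc; inject₁; _≟_)
open import Data.Fin.Properties using (any?)
open import Data.Fin.Subset using (Subset; ⊤; ∣_∣; _-_; ⁅_⁆) renaming (_∈_ to _∈ₛ_)
open import Data.Fin.Subset.Properties using (∈⊤; ∣⊤∣≡n; x∈p⇒∣p-x∣<∣p∣; x∈p∧x≢y⇒x∈p-y; p─q⊆p)
open import Data.Vec using ([]; _∷_; lookup)
open import Data.Vec.Relation.Unary.All using ([]; _∷_)
open import Data.Vec.Relation.Unary.AllPairs using ([]; _∷_)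
open import Data.Vec.Relation.Unary.Unique.Propositional using (Unique)
open import Data.Vec.Relation.Unary.Unique.Propositional.Properties using (lookup-injective)
open import Data.Maybe using (just; nothing)
open import Data.Product using (_×_; ∃-syntax; _,_; proj₁; proj₂)
open import Data.Sum using (_⊎_; inj₁; inj₂; [_,_]′)
open import Data.Unit using (tt)
open import Data.Empty using (⊥-elim)
open import Function using (_∘_)
open import Induction.WellFounded using (Acc; acc)
open import Relation.Nullary using (¬_; Dec; yes; no; ¬?; _×-dec_; contradiction)
open import Relation.Unary using (Pred; Decidable; U; _⊆_; _∩_; _∖_; ｛_｝)
open import Relation.Binary.PropositionalEquality using (_≡_; _≢_; refl; subst; ≢-sym) renaming (sym to ≡-sym)
open import Defs

least-or-none : ∀ {p} {Q : Pred ℕ p} → Decidable Q → ∀ N →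
  (∃[ k ] (Q k × (∀ j → j < k → ¬ Q j))) ⊎ (∀ j → j < N → ¬ Q j)
least-or-none Q? zero = inj₂ λ _ ()
least-or-none {Q = Q} Q? (suc N) with least-or-none Q? N
... | inj₁ least = inj₁ least
... | inj₂ none with Q? N
...   | yes qN = inj₁ (N , qN , none)
...   | no ¬qN = inj₂ λ j j<1+N →
          [ none j , (λ j≡N → ¬qN ∘ subst Q j≡N) ]′ (m<1+n⇒m<n∨m≡n j<1+N)

module _ {n : ℕ} (G : Graph n) where

  -- The constructor _∷_ of Walk takes three explicit arguments, so it
  -- cannot be written infix.
  infixr 5 _∷⟨_⟩_
  pattern _∷⟨_⟩_ px xy w = _∷_ px xy w

  Walk-head : ∀ {P x y k} → Walk G P x y k → P x
  Walk-head ([] px) = px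
  Walk-head (px ∷⟨ _ ⟩ _) = px

  Walk-map : ∀ {P Q} → P ⊆ Q → ∀ {x y k} → Walk G P x y k → Walk G Q x y k
  Walk-map P⊆Q ([] px) = [] (P⊆Q px)
  Walk-map P⊆Q (px ∷⟨ xy ⟩ w) = P⊆Q px ∷⟨ xy ⟩ Walk-map P⊆Q w

  walk? : ∀ {P} → Decidable P → ∀ k x y → Dec (Walk G P x y k)
  walk? P? zero x y with P? x | x ≟ y
  ... | yes px | yes refl = yes ([] px)
  ... | no ¬px | _ = no λ { ([] px) → ¬px px }
  ... | _ | no x≢y = no λ { ([] _) → x≢y refl }
  walk? P? (suc k) x y with P? x | any? (λ b → dec G x b ×-dec walk? P? k b y)
  ... | yes px | yes (_ , xb , w) = yes (px ∷⟨ xb ⟩ w)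
  ... | no ¬px | _ = no λ { (px ∷⟨ _ ⟩ _) → ¬px px }
  ... | _ | no ∄b = no λ { (_ ∷⟨ xb ⟩ w) → ∄b (_ , xb , w) }

  -- The second alternative is the part of the walk after its last visit to z.
  avoid-or-exit : ∀ {Q z x y k} → Walk G Q x y k → z ≢ y →
    (∃[ k′ ] Walk G (Q ∖ ｛ z ｝) x y k′) ⊎
    (∃[ b ] ∃[ k′ ] (Adj G z b × Walk G (Q ∖ ｛ z ｝) b y k′))
  avoid-or-exit ([] qy) z≢y = inj₁ (0 , [] (qy , z≢y))
  avoid-or-exit {z = z} {x} (qx ∷⟨ xb ⟩ w) z≢y with avoid-or-exit w z≢y
  ... | inj₂ exit = inj₂ exit
  ... | inj₁ (_ , w′) with z ≟ x
  ...   | yes refl = inj₂ (_ , _ , xb , w′)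
  ...   | no z≢x = inj₁ (_ , (qx , z≢x) ∷⟨ xb ⟩ w′)

  last-exit : ∀ {Q x y k} → Walk G Q x y k → x ≢ y →
    ∃[ b ] ∃[ k′ ] (Adj G x b × Walk G (Q ∖ ｛ x ｝) b y k′)
  last-exit w x≢y with avoid-or-exit w x≢y
  ... | inj₁ (_ , w′) = contradiction refl (proj₂ (Walk-head w′))
  ... | inj₂ exit = exit

  -- Induction on the size of S: after leaving x for the last time the walk
  -- stays in S - x.
  shorten-within : ∀ {P} (S : Subset n) → Acc _<_ ∣ S ∣ → ∀ {x y k} →
    Walk G (P ∩ (_∈ₛ S)) x y k → ∃[ k′ ] (k′ < ∣ S ∣ × Walk G (P ∩ (_∈ₛ S)) x y k′)
  shorten-within S (acc smaller) {x} {y} w with Walk-head w | x ≟ y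
  ... | px , x∈S | yes refl = 0 , ≤-<-trans z≤n (x∈p⇒∣p-x∣<∣p∣ x∈S) , [] (px , x∈S)
  ... | px , x∈S | no x≢y with last-exit w x≢y
  ...   | _ , _ , xb , w′
        with shorten-within (S - x) (smaller (x∈p⇒∣p-x∣<∣p∣ x∈S))
               (Walk-map (λ ((pu , u∈S) , x≢u) → pu , x∈p∧x≢y⇒x∈p-y u∈S (≢-sym x≢u)) w′)
  ...     | k′ , k′<∣S-x∣ , w″ =
            suc k′ , <-≤-trans (s≤s k′<∣S-x∣) (x∈p⇒∣p-x∣<∣p∣ x∈S) ,
            (px , x∈S) ∷⟨ xb ⟩ Walk-map (λ (pu , u∈S-x) → pu , p─q⊆p S ⁅ x ⁆ u∈S-x) w″

  shorten : ∀ {P x y k} → Walk G P x y k → ∃[ k′ ] (k′ < n × Walk G P x y k′)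
  shorten w with shorten-within ⊤ (<-wellFounded _) (Walk-map (_, ∈⊤) w)
  ... | k′ , k′<∣⊤∣ , w′ = k′ , subst (k′ <_) (∣⊤∣≡n n) k′<∣⊤∣ , Walk-map proj₁ w′

  distance : ∀ {P} → Decidable P → ∀ x y → ∃[ d ] IsDist G P x y d
  distance P? x y with least-or-none (λ k → walk? P? k x y) n
  ... | inj₁ (k , w , none-shorter) = just k , w , none-shorter
  ... | inj₂ none-below-n = nothing , λ _ w →
          let k′ , k′<n , w′ = shorten w in none-below-n k′ k′<n w′

  no-walk⇒distance≢ : ∀ {P x y k d} → ¬ Walk G P x y k → IsDist G P x y d → d ≢ just k
  no-walk⇒distance≢ ∄w dist refl = ∄w (proj₁ dist)

  Adj⇒≢ : ∀ {x y} → Adj G x y → x ≢ y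
  Adj⇒≢ xy refl = irrefl G xy

  module _ (girth>4 : GirthGreaterThan4 G) where

    common-neighbours-nonadjacent : ∀ {v u w} → Adj G v u → Adj G v w → u ≢ w → ¬ Adj G u w
    common-neighbours-nonadjacent {v} {u} {w} vu vw u≢w uw =
      girth>4 2 ≤-refl (n≤1+n 2) (lookup vs , lookup-injective distinct _ _ , edges , sym G vw)
      where
        vs = v ∷ u ∷ w ∷ []
        distinct : Unique vs
        distinct = (Adj⇒≢ vu ∷ Adj⇒≢ vw ∷ []) ∷ (u≢w ∷ []) ∷ [] ∷ []
        edges : ∀ i → Adj G (lookup vs (inject₁ i)) (lookup vs (suc i))
        edges zero = vu
        edges (suc zero) = uw

    common-neighbour-unique : ∀ {v u w a} → Adj G v u → Adj G v w → u ≢ w →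
                              Adj G u a → Adj G a w → v ≡ a
    common-neighbour-unique {v} {u} {w} {a} vu vw u≢w ua aw with v ≟ a
    ... | yes v≡a = v≡a
    ... | no v≢a = ⊥-elim
          (girth>4 3 (n≤1+n 2) ≤-refl (lookup vs , lookup-injective distinct _ _ , edges , sym G vw))
      where
        vs = v ∷ u ∷ a ∷ w ∷ []
        distinct : Unique vs
        distinct = (Adj⇒≢ vu ∷ v≢a ∷ Adj⇒≢ vw ∷ []) ∷ (Adj⇒≢ ua ∷ u≢w ∷ []) ∷ (Adj⇒≢ aw ∷ []) ∷ [] ∷ []
        edges : ∀ i → Adj G (lookup vs (inject₁ i)) (lookup vs (suc i))
        edges zero = vu
        edges (suc zero) = ua
        edges (suc (suc zero)) = aw

    distance-common-neighbours : ∀ {v u w} → Adj G v u → Adj G v w → u ≢ w →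
                                 IsDistG G u w (just 2)
    distance-common-neighbours {u = u} {w} vu vw u≢w = tt ∷⟨ sym G vu ⟩ tt ∷⟨ vw ⟩ [] tt , shorter
      where
        shorter : ∀ j → j < 2 → ¬ Walk G U u w j
        shorter zero _ ([] _) = u≢w refl
        shorter 1 _ (_ ∷⟨ uw ⟩ [] _) = common-neighbours-nonadjacent vu vw u≢w uw
        shorter (suc (suc _)) (s≤s (s≤s ()))

    no-detour : ∀ {v u w} → Adj G v u → Adj G v w → u ≢ w → ¬ Walk G (_≢ v) u w 2
    no-detour vu vw u≢w (_ ∷⟨ ua ⟩ a≢v ∷⟨ aw ⟩ [] _) =
      a≢v (≡-sym (common-neighbour-unique vu vw u≢w ua aw))

lemma3p1 : ∀ {n : ℕ} (G : Graph n) →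
    MinDegreeAtLeast2 G → GirthGreaterThan4 G → DistanceCritical G
lemma3p1 G δ≥2 girth>4 v with δ≥2 v
... | u , w , u≢w , vu , vw with distance G (λ x → ¬? (x ≟ v)) u w
... | d′ , isDist′ =
  u , w , ≢-sym (Adj⇒≢ G vu) , ≢-sym (Adj⇒≢ G vw) , just 2 , d′ ,
  distance-common-neighbours G girth>4 vu vw u≢w , isDist′ ,
  ≢-sym (no-walk⇒distance≢ G (no-detour G girth>4 vu vw u≢w) isDist′)
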